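{- Let $T$ be a caterpillar with $r=\mathrm{diam}(T)-1\ge 3$ such that $d_T(v)=q\ge 2$ for all $v\in B(T)$, where $B(T)=\{v\in V(T): d_T(v)>1\}$. Let $k$ be an integer with $2\le k\le \mathrm{diam}(T)=r+1$. Then $\mu_k(T)=k(q-2)-q+4$.
   Context: A caterpillar is a tree in which the set $B(T)$ of non-leaf vertices induces a path; here this path has $r=\mathrm{diam}(T)-1$ vertices. For a graph $G$, a set $S\subseteq V(G)$ and an integer $k\ge 1$, two vertices $x,y$ are $S_k$-visible if there is a shortest $x,y$-path of length at most $k$ none of whose internal vertices lies in $S$. $S$ is a $k$-distance mutual-visibility set if every two vertices of $S$ are $S_k$-visible, and $\mu_k(G)$ is the maximum cardinality of such a set. -}

module Defs where

open import Data.Nat using (ℕ; zero; suc; _+_; _≤_; _<_)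
open import Data.Fin using (Fin; zero; suc; toℕ; fromℕ; inject₁)
open import Data.Fin.Subset using (Subset; _∈_; _∉_; ∣_∣)
open import Data.Bool using (Bool; true; false)
open import Data.List using (List; length; filterᵇ; allFin)
open import Data.Product using (Σ; ∃; _×_; _,_)
open import Data.Sum using (_⊎_)
open import Function.Definitions using (Injective)
open import Relation.Binary.PropositionalEquality using (_≡_)
open import Relation.Nullary using (¬_)

record Graph : Set where
  field
    n      : ℕ
    adj    : Fin n → Fin n → Bool
    sym    : ∀ u v → adj u v ≡ adj v u
    irrefl : ∀ v → adj v v ≡ false

open Graph public

V : Graph → Set
V G = Fin (n G)

Walk : (G : Graph) → V G → V G → ℕ → Set
Walk G x y ℓ =
  Σ (Fin (suc ℓ) → V G) λ w →
    (w zero ≡ x) × (w (fromℕ ℓ) ≡ y) ×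
    (∀ (i : Fin ℓ) → adj G (w (inject₁ i)) (w (suc i)) ≡ true)

-- A shortest x,y-path of length ℓ: a walk of length ℓ, and no shorter walk exists
-- (such a walk is automatically a path).
ShortestPath : (G : Graph) → (x y : V G) → (ℓ : ℕ) → (Fin (suc ℓ) → V G) → Set
ShortestPath G x y ℓ w =
  (w zero ≡ x) × (w (fromℕ ℓ) ≡ y) ×
  (∀ (i : Fin ℓ) → adj G (w (inject₁ i)) (w (suc i)) ≡ true) ×
  (∀ m → m < ℓ → ¬ Walk G x y m)

IsDist : (G : Graph) → V G → V G → ℕ → Set
IsDist G x y ℓ = Walk G x y ℓ × (∀ m → m < ℓ → ¬ Walk G x y m)

IsDiam : Graph → ℕ → Set
IsDiam G D =
  (∀ x y ℓ → IsDist G x y ℓ → ℓ ≤ D) × (∃ λ x → ∃ λ y → IsDist G x y D)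

Connected : Graph → Set
Connected G = ∀ (x y : V G) → ∃ λ ℓ → Walk G x y ℓ

HasCycle : Graph → Set
HasCycle G =
  ∃ λ ℓ → 2 ≤ ℓ × Σ (Fin (suc ℓ) → V G) λ w →
    Injective _≡_ _≡_ w ×
    (∀ (i : Fin ℓ) → adj G (w (inject₁ i)) (w (suc i)) ≡ true) ×
    (adj G (w (fromℕ ℓ)) (w zero) ≡ true)

IsTree : Graph → Set
IsTree G = Connected G × ¬ HasCycle G

degree : (G : Graph) → V G → ℕ
degree G v = length (filterᵇ (adj G v) (allFin (n G)))

InB : (G : Graph) → V G → Set
InB G v = 1 < degree G v

-- T is a caterpillar: T is a tree and B(T) induces a path, i.e. there is an
-- enumeration p 0, …, p (m-1) of B(T) without repetition such that p i, p j are
-- adjacent iff |i - j| = 1.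
IsCaterpillar : Graph → Set
IsCaterpillar G =
  IsTree G ×
  ∃ λ m → Σ (Fin m → V G) λ p →
    Injective _≡_ _≡_ p ×
    (∀ i → InB G (p i)) ×
    (∀ v → InB G v → ∃ λ i → p i ≡ v) ×
    (∀ i j → adj G (p i) (p j) ≡ true
               → (suc (toℕ i) ≡ toℕ j ⊎ suc (toℕ j) ≡ toℕ i)) ×
    (∀ i j → (suc (toℕ i) ≡ toℕ j ⊎ suc (toℕ j) ≡ toℕ i)
               → adj G (p i) (p j) ≡ true)

Visible : (G : Graph) → Subset (n G) → ℕ → V G → V G → Set
Visible G S k x y =
  ∃ λ ℓ → ℓ ≤ k × Σ (Fin (suc ℓ) → V G) λ w →
    ShortestPath G x y ℓ w ×
    (∀ (i : Fin (suc ℓ)) → 0 < toℕ i → toℕ i < ℓ → w i ∉ S)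

IsKDMV : (G : Graph) → ℕ → Subset (n G) → Set
IsKDMV G k S = ∀ x y → x ∈ S → y ∈ S → Visible G S k x y

IsMuK : Graph → ℕ → ℕ → Set
IsMuK G k m =
  (∃ λ S → IsKDMV G k S × ∣ S ∣ ≡ m) ×
  (∀ S → IsKDMV G k S → ∣ S ∣ ≤ m)

module Submission where

-- Write the spine as P 0, …, P m and send each vertex v to the index π v of the spine vertex it
-- equals or hangs from, with depth v = 0 on the spine and 1 on a leaf. Every walk between x ≢ y
-- has length at least |π x − π y| + depth x + depth y, and the walk along the spine attains it.
-- The end vertices of the spine carry q − 1 leaves, the inner ones q − 2.
--
-- Lower bound (k = K + 2): the leaves hanging from P 0, …, P K, together with P (K + 1) when
-- K < m, are pairwise k-visible, since the spine vertices inside their geodesics lie below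
-- position K + 1; there are k(q − 2) − q + 4 of them.
--
-- Upper bound: a walk between two vertices passes every spine vertex strictly between their
-- positions, and a walk out of a leaf passes its anchor first. As the walks witnessing visibility
-- avoid S inside, a k-visible set S whose positions range over a < b has at most
-- 1 + depth · (q − 2) members at each end and only leaves in between, at most (b − a − 1)(q − 2)
-- of them; the extreme members being at distance ≤ k, this is at most 2 + (k − 1)(q − 2). If all
-- of S sits at one position, it has at most max (2, q − 1) members.

open import Defs renaming (n to order; sym to adj-sym)
open import Data.Bool using (true; false; if_then_else_)
open import Data.Bool.Properties using (T-≡) renaming (_≟_ to _≟ᵇ_)
open import Data.Empty using (⊥-elim)
open import Data.Fin using (Fin; zero; suc; toℕ; fromℕ<; inject₁)
open import Data.Fin.Properties
  using (any?; ¬Fin0; toℕ-injective; toℕ-fromℕ; toℕ-fromℕ<; toℕ-inject₁; toℕ<n)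
  renaming (_≟_ to _≟ᶠ_; suc-injective to fsuc-injective)
open import Data.Fin.Subset using (Subset; _∈_; _∉_; ∣_∣; inside; outside)
open import Data.Fin.Subset.Properties using (_∈?_; drop-there)
open import Data.List using (filter; length)
import Data.List as List
open import Data.Nat
  using (ℕ; zero; suc; pred; >-nonZero; _+_; _*_; _∸_; _≤_; _<_; _≥_; _≤?_; _<?_;
         z≤n; s≤s; z<s; s<s)
open import Data.Nat.Properties
open import Data.Nat.Tactic.RingSolver using (solve-∀)
open import Data.Product using (∃; ∃₂; _×_; _,_; proj₁; proj₂)
open import Data.Sum using (_⊎_; inj₁; inj₂)
open import Data.Vec using (_∷_; []; tabulate; there)
open import Data.Vec.Properties using (lookup∘tabulate; []=⇒lookup; lookup⇒[]=)
open import Function using (_∘_; id; Equivalence)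
open import Function.Definitions using (Injective)
open import Level using (Level)
open import Relation.Binary using (Rel; Reflexive; Transitive; Total)
open import Relation.Binary.PropositionalEquality
open import Relation.Nullary using (¬_; yes; no; does; contradiction; ¬?; _×-dec_; _⊎-dec_)
open import Relation.Nullary.Decidable using (dec-true; dec-false; T?)
open import Relation.Unary using (Pred; Decidable; _⊆_; _∪_)
open import Relation.Unary.Properties using (_∪?_; _∩?_)

private
  variable
    p p₁ p₂ : Level
    n : ℕ

-- Arithmetic

pred[n]<n : 0 < n → pred n < n
pred[n]<n {suc n} _ = ≤-refl

RisesSlowly : (ℕ → ℕ) → ℕ → Set
RisesSlowly f ℓ = ∀ t → t < ℓ → f (suc t) ≤ suc (f t)

risesSlowly-bound : ∀ {f ℓ} → RisesSlowly f ℓ → f ℓ ≤ f 0 + ℓ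
risesSlowly-bound {f} {zero}  _    = ≤-reflexive (sym (+-identityʳ (f 0)))
risesSlowly-bound {f} {suc ℓ} rise = begin
  f (suc ℓ)     ≤⟨ rise ℓ ≤-refl ⟩
  suc (f ℓ)     ≤⟨ s≤s (risesSlowly-bound (λ t t<ℓ → rise t (m<n⇒m<1+n t<ℓ))) ⟩
  suc (f 0 + ℓ) ≡⟨ +-suc (f 0) ℓ ⟨
  f 0 + suc ℓ   ∎
  where open ≤-Reasoning

risesSlowly-hits : ∀ {f ℓ j} → RisesSlowly f ℓ → f 0 ≤ j → j ≤ f ℓ →
  ∃ λ s → s ≤ ℓ × f s ≡ j
risesSlowly-hits {f} {zero}      _    f0≤j j≤f0 = 0 , z≤n , ≤-antisym f0≤j j≤f0
risesSlowly-hits {f} {suc ℓ} {j} rise f0≤j j≤f[1+ℓ] with j ≤? f ℓ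
... | yes j≤fℓ =
  let s , s≤ℓ , fs≡j = risesSlowly-hits (λ t t<ℓ → rise t (m<n⇒m<1+n t<ℓ)) f0≤j j≤fℓ
  in s , m≤n⇒m≤1+n s≤ℓ , fs≡j
... | no j≰fℓ = suc ℓ , ≤-refl , ≤-antisym (≤-trans (rise ℓ ≤-refl) (≰⇒> j≰fℓ)) j≤f[1+ℓ]

sum-of-parts≤ : ∀ a d da db K q′ → da + ((suc a + d) + db) ≤ a + (2 + K) →
  (1 + da * q′) + (d * q′ + (1 + db * q′)) ≤ 2 + suc K * q′
sum-of-parts≤ a d da db K q′ span = begin
  (1 + da * q′) + (d * q′ + (1 + db * q′)) ≡⟨ collect da d db q′ ⟩
  2 + (da + (d + db)) * q′                 ≤⟨ +-monoʳ-≤ 2 (*-monoˡ-≤ q′ reach) ⟩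
  2 + suc K * q′                           ∎
  where
  open ≤-Reasoning
  collect : ∀ da d db q′ → (1 + da * q′) + (d * q′ + (1 + db * q′)) ≡ 2 + (da + (d + db)) * q′
  collect = solve-∀
  shift : ∀ a d da db → da + ((suc a + d) + db) ≡ suc a + (da + (d + db))
  shift = solve-∀
  reach : da + (d + db) ≤ suc K
  reach = +-cancelˡ-≤ (suc a) _ _ (subst₂ _≤_ (shift a d da db) (+-suc a (suc K)) span)

μ-formula : ∀ K q′ → suc (suc K) * q′ + 4 ∸ suc (suc q′) ≡ 2 + suc K * q′
μ-formula K q′ = begin
  (q′ + suc K * q′) + 4 ∸ (2 + q′)    ≡⟨ cong₂ _∸_ (+-assoc q′ _ 4) (+-comm 2 q′) ⟩
  (q′ + (suc K * q′ + 4)) ∸ (q′ + 2)  ≡⟨ [m+n]∸[m+o]≡n∸o q′ _ 2 ⟩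
  (suc K * q′ + 4) ∸ 2                ≡⟨ cong (_∸ 2) (+-comm _ 4) ⟩
  2 + suc K * q′                      ∎
  where open ≡-Reasoning

-- Counting decidable predicates on Fin n

count : {P : Pred (Fin n) p} → Decidable P → ℕ
count {n = zero}  P? = 0
count {n = suc n} P? = (if does (P? zero) then 1 else 0) + count (P? ∘ suc)

count-mono : {P : Pred (Fin n) p₁} {Q : Pred (Fin n) p₂} (P? : Decidable P) (Q? : Decidable Q) →
  P ⊆ Q → count P? ≤ count Q?
count-mono {n = zero}  _  _  _   = z≤n
count-mono {n = suc n} P? Q? P⊆Q with P? zero | Q? zero
... | yes _ | yes _ = s≤s (count-mono (P? ∘ suc) (Q? ∘ suc) P⊆Q)
... | no _  | yes _ = m≤n⇒m≤1+n (count-mono (P? ∘ suc) (Q? ∘ suc) P⊆Q)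
... | no _  | no _  = count-mono (P? ∘ suc) (Q? ∘ suc) P⊆Q
... | yes p | no ¬q = contradiction (P⊆Q p) ¬q

count-cong : {P : Pred (Fin n) p₁} {Q : Pred (Fin n) p₂} (P? : Decidable P) (Q? : Decidable Q) →
  P ⊆ Q → Q ⊆ P → count P? ≡ count Q?
count-cong P? Q? P⊆Q Q⊆P = ≤-antisym (count-mono P? Q? P⊆Q) (count-mono Q? P? Q⊆P)

count≡0 : {P : Pred (Fin n) p} (P? : Decidable P) → (∀ v → ¬ P v) → count P? ≡ 0
count≡0 {n = zero}  P? ∅ = refl
count≡0 {n = suc n} P? ∅ with P? zero
... | yes p = contradiction p (∅ zero)
... | no _  = count≡0 (P? ∘ suc) (∅ ∘ suc)

count-∪-∩ : {P : Pred (Fin n) p₁} {Q : Pred (Fin n) p₂} (P? : Decidable P) (Q? : Decidable Q) →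
  count (P? ∪? Q?) + count (P? ∩? Q?) ≡ count P? + count Q?
count-∪-∩ {n = zero}  P? Q? = refl
count-∪-∩ {n = suc n} P? Q? with P? zero | Q? zero | count-∪-∩ (P? ∘ suc) (Q? ∘ suc)
... | yes _ | yes _ | ih = cong suc (trans (+-suc _ _) (trans (cong suc ih) (sym (+-suc _ _))))
... | yes _ | no _  | ih = cong suc ih
... | no _  | yes _ | ih = trans (cong suc ih) (sym (+-suc _ _))
... | no _  | no _  | ih = ih

count-∪≤ : {P : Pred (Fin n) p₁} {Q : Pred (Fin n) p₂} (P? : Decidable P) (Q? : Decidable Q) →
  count (P? ∪? Q?) ≤ count P? + count Q?
count-∪≤ P? Q? = subst (count (P? ∪? Q?) ≤_) (count-∪-∩ P? Q?) (m≤m+n _ _)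

count-∪-disjoint : {P : Pred (Fin n) p₁} {Q : Pred (Fin n) p₂} (P? : Decidable P) (Q? : Decidable Q) →
  (∀ {v} → P v → ¬ Q v) → count (P? ∪? Q?) ≡ count P? + count Q?
count-∪-disjoint P? Q? disjoint = begin
  count (P? ∪? Q?)                     ≡⟨ +-identityʳ _ ⟨
  count (P? ∪? Q?) + 0                 ≡⟨ cong (count (P? ∪? Q?) +_) none ⟨
  count (P? ∪? Q?) + count (P? ∩? Q?)  ≡⟨ count-∪-∩ P? Q? ⟩
  count P? + count Q?                  ∎
  where
  open ≡-Reasoning
  none : count (P? ∩? Q?) ≡ 0
  none = count≡0 (P? ∩? Q?) λ _ (p , q) → disjoint p q

count-singleton : (a : Fin n) → count (_≟ᶠ a) ≡ 1
count-singleton {suc n} zero    = cong suc (count≡0 {n = n} (λ v → suc v ≟ᶠ zero) λ _ ())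
count-singleton {suc n} (suc a) =
  trans (count-cong _ (_≟ᶠ a) fsuc-injective (cong suc)) (count-singleton a)

count≡1 : {P : Pred (Fin n) p} (P? : Decidable P) {a : Fin n} → P a → (∀ {v} → P v → v ≡ a) →
  count P? ≡ 1
count≡1 P? {a} pa only = trans (count-cong P? (_≟ᶠ a) only λ { refl → pa }) (count-singleton a)

count≤1 : {P : Pred (Fin n) p} (P? : Decidable P) → (∀ {u v} → P u → P v → u ≡ v) → count P? ≤ 1
count≤1 P? unique with any? P?
... | yes (a , pa) = ≤-reflexive (count≡1 P? pa λ pv → unique pv pa)
... | no ∄         = ≤-trans (≤-reflexive (count≡0 P? λ v pv → ∄ (v , pv))) z≤n

count-pair : {a b : Fin n} → a ≢ b → count ((_≟ᶠ a) ∪? (_≟ᶠ b)) ≡ 2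
count-pair {a = a} {b} a≢b =
  trans (count-∪-disjoint (_≟ᶠ a) (_≟ᶠ b) λ { refl refl → a≢b refl })
        (cong₂ _+_ (count-singleton a) (count-singleton b))

count≡2 : {P : Pred (Fin n) p} (P? : Decidable P) {a b : Fin n} → a ≢ b → P a → P b →
  (∀ {v} → P v → v ≡ a ⊎ v ≡ b) → count P? ≡ 2
count≡2 P? {a} {b} a≢b pa pb only =
  trans (count-cong P? ((_≟ᶠ a) ∪? (_≟ᶠ b)) only λ { (inj₁ refl) → pa ; (inj₂ refl) → pb })
        (count-pair a≢b)

2≤count : {P : Pred (Fin n) p} (P? : Decidable P) {a b : Fin n} → a ≢ b → P a → P b → 2 ≤ count P?
2≤count P? {a} {b} a≢b pa pb =
  subst (_≤ count P?) (count-pair a≢b)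
        (count-mono ((_≟ᶠ a) ∪? (_≟ᶠ b)) P? λ { (inj₁ refl) → pa ; (inj₂ refl) → pb })

∣p∣≡count : (S : Subset n) → ∣ S ∣ ≡ count (_∈? S)
∣p∣≡count []            = refl
∣p∣≡count (inside ∷ S)  = cong suc (trans (∣p∣≡count S) (count-cong (_∈? S) _ there drop-there))
∣p∣≡count (outside ∷ S) = trans (∣p∣≡count S) (count-cong (_∈? S) _ there drop-there)

toSubset : {P : Pred (Fin n) p} → Decidable P → Subset n
toSubset P? = tabulate (does ∘ P?)

∈-toSubset⁺ : {P : Pred (Fin n) p} (P? : Decidable P) {v : Fin n} → P v → v ∈ toSubset P?
∈-toSubset⁺ P? {v} pv =
  lookup⇒[]= v _ (trans (lookup∘tabulate (does ∘ P?) v) (dec-true (P? v) pv))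

∈-toSubset⁻ : {P : Pred (Fin n) p} (P? : Decidable P) {v : Fin n} → v ∈ toSubset P? → P v
∈-toSubset⁻ P? {v} v∈ with P? v | trans (sym (lookup∘tabulate (does ∘ P?) v)) ([]=⇒lookup v∈)
... | yes pv | _ = pv

∣toSubset∣≡count : {P : Pred (Fin n) p} (P? : Decidable P) → ∣ toSubset P? ∣ ≡ count P?
∣toSubset∣≡count P? =
  trans (∣p∣≡count (toSubset P?)) (count-cong _ P? (∈-toSubset⁻ P?) (∈-toSubset⁺ P?))

length-filter-tabulate : ∀ {a} {A : Set a} {P : Pred A p} (P? : Decidable P) (f : Fin n → A) →
  length (filter P? (List.tabulate f)) ≡ count (P? ∘ f)
length-filter-tabulate {n = zero}  P? f = refl
length-filter-tabulate {n = suc n} P? f with does (P? (f zero))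
... | true  = cong suc (length-filter-tabulate P? (f ∘ suc))
... | false = length-filter-tabulate P? (f ∘ suc)

module _ {a r} {A : Set a} {_≼_ : Rel A r}
         (≼-refl : Reflexive _≼_) (≼-trans : Transitive _≼_) (≼-total : Total _≼_) where

  extremum : {P : Pred (Fin n) p} → Decidable P → (f : Fin n → A) →
    (∀ v → ¬ P v) ⊎ ∃ λ x → P x × ∀ {v} → P v → f x ≼ f v
  extremum {n = zero}  P? f = inj₁ λ ()
  extremum {n = suc n} P? f with extremum (P? ∘ suc) (f ∘ suc) | P? zero
  ... | inj₁ ∅ | no ¬p = inj₁ λ { zero → ¬p ; (suc v) → ∅ v }
  ... | inj₁ ∅ | yes p =
    inj₂ (zero , p , λ { {zero} _ → ≼-refl ; {suc v} pv → contradiction pv (∅ v) })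
  ... | inj₂ (x , px , best) | no ¬p =
    inj₂ (suc x , px , λ { {zero} p → contradiction p ¬p ; {suc v} pv → best pv })
  ... | inj₂ (x , px , best) | yes p with ≼-total (f zero) (f (suc x))
  ...   | inj₁ f0≼fx =
    inj₂ (zero , p , λ { {zero} _ → ≼-refl ; {suc v} pv → ≼-trans f0≼fx (best pv) })
  ...   | inj₂ fx≼f0 = inj₂ (suc x , px , λ { {zero} _ → fx≼f0 ; {suc v} pv → best pv })

-- Neighbours and walks

Adj : (G : Graph) → V G → V G → Set
Adj G u v = adj G u v ≡ true

adj? : (G : Graph) (u : V G) → Decidable (Adj G u)
adj? G u v = adj G u v ≟ᵇ true

module Neighbours (G : Graph) where

  Adj-sym : ∀ {u v} → Adj G u v → Adj G v u
  Adj-sym {u} {v} = trans (adj-sym G v u)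

  degree≡count : (v : V G) → degree G v ≡ count (adj? G v)
  degree≡count v = trans (length-filter-tabulate (T? ∘ adj G v) id)
                         (count-cong _ (adj? G v) (Equivalence.to T-≡) (Equivalence.from T-≡))

  two-neighbours⇒InB : ∀ {v a b} → a ≢ b → Adj G v a → Adj G v b → InB G v
  two-neighbours⇒InB {v} a≢b va vb =
    subst (1 <_) (sym (degree≡count v)) (2≤count (adj? G v) a≢b va vb)

  ¬InB⇒unique-neighbour : ∀ {v a b} → ¬ InB G v → Adj G v a → Adj G v b → a ≡ b
  ¬InB⇒unique-neighbour {a = a} {b} ¬B va vb with a ≟ᶠ b
  ... | yes a≡b = a≡b
  ... | no  a≢b = contradiction (two-neighbours⇒InB a≢b va vb) ¬B

-- Walks are handled as functions on ℕ (values past the length are irrelevant), which are easier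
-- to shift, extend and reverse than the Fin-indexed walks of the definitions.
record Traces (G : Graph) (W : ℕ → V G) (x y : V G) (ℓ : ℕ) : Set where
  field
    start : W 0 ≡ x
    end   : W ℓ ≡ y
    step  : ∀ t → t < ℓ → Adj G (W t) (W (suc t))

Interior : ∀ {a} {A : Set a} → (A → Set) → (ℕ → A) → ℕ → Set
Interior Q W ℓ = ∀ t → 0 < t → t < ℓ → Q (W t)

_◂_ : ∀ {a} {A : Set a} → A → (ℕ → A) → ℕ → A
(x ◂ W) zero    = x
(x ◂ W) (suc t) = W t

reverse : ∀ {a} {A : Set a} → ℕ → (ℕ → A) → ℕ → A
reverse ℓ W t = W (ℓ ∸ t)

clamp : (ℓ : ℕ) → ℕ → Fin (suc ℓ)
clamp _       zero    = zero
clamp zero    (suc t) = zero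
clamp (suc ℓ) (suc t) = suc (clamp ℓ t)

toℕ-clamp : ∀ {ℓ t} → t ≤ ℓ → toℕ (clamp ℓ t) ≡ t
toℕ-clamp {t = zero}              _         = refl
toℕ-clamp {ℓ = suc ℓ} {t = suc t} (s≤s t≤ℓ) = cong suc (toℕ-clamp t≤ℓ)

module Walks (G : Graph) where

  open Neighbours G
  open Traces

  traces-const : (x : V G) → Traces G (λ _ → x) x x 0
  traces-const x = record { start = refl ; end = refl ; step = λ _ () }

  traces-◂ : ∀ {W x u y ℓ} → Adj G x u → Traces G W u y ℓ → Traces G (x ◂ W) x y (suc ℓ)
  traces-◂ {x = x} xu tr = record
    { start = refl
    ; end   = end tr
    ; step  = λ { zero    _         → subst (Adj G x) (sym (start tr)) xu
                ; (suc t) (s≤s t<ℓ) → step tr t t<ℓ }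
    }

  traces-tail : ∀ {W x y ℓ} → Traces G W x y (suc ℓ) → Traces G (W ∘ suc) (W 1) y ℓ
  traces-tail tr = record { start = refl ; end = end tr ; step = λ t t<ℓ → step tr (suc t) (s<s t<ℓ) }

  traces-init : ∀ {W x y ℓ} → Traces G W x y (suc ℓ) → Traces G W x (W ℓ) ℓ
  traces-init tr = record { start = start tr ; end = refl ; step = λ t t<ℓ → step tr t (m<n⇒m<1+n t<ℓ) }

  traces-reverse : ∀ {W x y ℓ} → Traces G W x y ℓ → Traces G (reverse ℓ W) y x ℓ
  traces-reverse {W} {ℓ = ℓ} tr = record
    { start = end tr
    ; end   = trans (cong W (n∸n≡0 ℓ)) (start tr)
    ; step  = backwards
    }
    where
    backwards : ∀ t → t < ℓ → Adj G (W (ℓ ∸ t)) (W (ℓ ∸ suc t))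
    backwards t (s≤s {n = ℓ′} t≤ℓ′) =
      subst (λ i → Adj G (W i) (W (ℓ′ ∸ t))) (sym (+-∸-assoc 1 t≤ℓ′))
            (Adj-sym (step tr (ℓ′ ∸ t) (s≤s (m∸n≤m ℓ′ t))))

  first-step : ∀ {W x y ℓ} → Traces G W x y (suc ℓ) → Adj G x (W 1)
  first-step {W} tr = subst (λ z → Adj G z (W 1)) (start tr) (step tr 0 z<s)

  last-step : ∀ {W x y ℓ} → Traces G W x y (suc ℓ) → Adj G (W ℓ) y
  last-step {W} {ℓ = ℓ} tr = subst (Adj G (W ℓ)) (end tr) (step tr ℓ ≤-refl)

  interior-◂ : ∀ {Q : V G → Set} {W x ℓ} → Interior Q W ℓ → (0 < ℓ → Q (W 0)) →
    Interior Q (x ◂ W) (suc ℓ)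
  interior-◂ inner first (suc zero)    _ (s≤s 0<ℓ)   = first 0<ℓ
  interior-◂ inner first (suc (suc t)) _ (s≤s t+1<ℓ) = inner (suc t) z<s t+1<ℓ

  interior-reverse : ∀ {Q : V G → Set} {W ℓ} → Interior Q W ℓ → Interior Q (reverse ℓ W) ℓ
  interior-reverse inner t 0<t t<ℓ = inner _ (m<n⇒0<n∸m t<ℓ) (∸-monoʳ-< 0<t (<⇒≤ t<ℓ))

  walk⇒traces : ∀ {x y ℓ} (wk : Walk G x y ℓ) → Traces G (proj₁ wk ∘ clamp ℓ) x y ℓ
  walk⇒traces {ℓ = ℓ} (w , w₀ , wℓ , steps) = record
    { start = w₀
    ; end   = trans (cong w (toℕ-injective (trans (toℕ-clamp ≤-refl) (sym (toℕ-fromℕ ℓ))))) wℓ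
    ; step  = λ t t<ℓ →
        subst₂ (λ i j → Adj G (w i) (w j)) (at t t<ℓ) (after t t<ℓ) (steps (fromℕ< t<ℓ))
    }
    where
    at : ∀ t (t<ℓ : t < ℓ) → inject₁ (fromℕ< t<ℓ) ≡ clamp ℓ t
    at t t<ℓ =
      toℕ-injective (trans (toℕ-inject₁ _) (trans (toℕ-fromℕ< t<ℓ) (sym (toℕ-clamp (<⇒≤ t<ℓ)))))
    after : ∀ t (t<ℓ : t < ℓ) → suc (fromℕ< t<ℓ) ≡ clamp ℓ (suc t)
    after t t<ℓ = toℕ-injective (trans (cong suc (toℕ-fromℕ< t<ℓ)) (sym (toℕ-clamp t<ℓ)))

  traces⇒walk : ∀ {W x y ℓ} → Traces G W x y ℓ → Walk G x y ℓ
  traces⇒walk {W} {ℓ = ℓ} tr =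
    W ∘ toℕ , start tr , trans (cong W (toℕ-fromℕ ℓ)) (end tr) ,
    λ i → subst (λ t → Adj G (W t) (W (suc (toℕ i)))) (sym (toℕ-inject₁ i))
                (step tr (toℕ i) (toℕ<n i))

  walk-reverse : ∀ {x y ℓ} → Walk G x y ℓ → Walk G y x ℓ
  walk-reverse wk = traces⇒walk (traces-reverse (walk⇒traces wk))

  visible⇒traces : ∀ {S k x y} → Visible G S k x y →
    ∃₂ λ ℓ W → ℓ ≤ k × Traces G W x y ℓ × Interior (_∉ S) W ℓ
  visible⇒traces (ℓ , ℓ≤k , w , (w₀ , wℓ , steps , _) , inner) =
    ℓ , w ∘ clamp ℓ , ℓ≤k , walk⇒traces (w , w₀ , wℓ , steps) ,
    λ t 0<t t<ℓ → inner (clamp ℓ t) (subst (0 <_) (sym (toℕ-clamp (<⇒≤ t<ℓ))) 0<t)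
                                    (subst (_< ℓ) (sym (toℕ-clamp (<⇒≤ t<ℓ))) t<ℓ)

  traces⇒visible : ∀ {S k W x y ℓ} → Traces G W x y ℓ → ℓ ≤ k →
    (∀ m → m < ℓ → ¬ Walk G x y m) → Interior (_∉ S) W ℓ → Visible G S k x y
  traces⇒visible {W = W} tr ℓ≤k shortest inner =
    let (_ , w₀ , wℓ , steps) = traces⇒walk tr
    in _ , ℓ≤k , W ∘ toℕ , (w₀ , wℓ , steps , shortest) , λ i → inner (toℕ i)

  InB-nonempty : ∀ {D} → IsDiam G (suc (suc D)) → ∃ (InB G)
  InB-nonempty {D} (_ , x , y , wk , shortest) =
    W 1 , two-neighbours⇒InB W₀≢W₂ (Adj-sym (step tr 0 z<s)) (step tr 1 (s<s z<s))
    where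
    W : ℕ → V G
    W = proj₁ wk ∘ clamp (2 + D)
    tr : Traces G W x y (2 + D)
    tr = walk⇒traces wk
    W₀≢W₂ : W 0 ≢ W 2
    W₀≢W₂ W₀≡W₂ = shortest D (m<n⇒m<1+n (n<1+n D)) (traces⇒walk {W = W ∘ (2 +_)} record
      { start = trans (sym W₀≡W₂) (start tr)
      ; end   = end tr
      ; step  = λ t t<D → step tr (2 + t) (s<s (s<s t<D))
      })

  trapped-in-edge : ∀ {u w W y ℓ} → ¬ InB G u → ¬ InB G w → Adj G u w → Traces G W u y ℓ →
    y ≡ u ⊎ y ≡ w
  trapped-in-edge {u} {w} {W} {y} {ℓ} ¬Bu ¬Bw uw tr =
    subst (λ z → z ≡ u ⊎ z ≡ w) (end tr) (visits ℓ ≤-refl)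
    where
    visits : ∀ t → t ≤ ℓ → W t ≡ u ⊎ W t ≡ w
    visits zero    _   = inj₁ (start tr)
    visits (suc t) t<ℓ with visits t (<⇒≤ t<ℓ)
    ... | inj₁ Wt≡u =
      inj₂ (¬InB⇒unique-neighbour ¬Bu (subst (λ z → Adj G z _) Wt≡u (step tr t t<ℓ)) uw)
    ... | inj₂ Wt≡w =
      inj₁ (¬InB⇒unique-neighbour ¬Bw (subst (λ z → Adj G z _) Wt≡w (step tr t t<ℓ)) (Adj-sym uw))

-- Caterpillars

module Caterpillar
  (G : Graph) (m : ℕ) (p : Fin (suc m) → V G)
  (p-injective : Injective _≡_ _≡_ p)
  (p-InB : ∀ i → InB G (p i))
  (InB⇒p : ∀ v → InB G v → ∃ λ i → p i ≡ v)
  (p-adj⇒ : ∀ i j → Adj G (p i) (p j) → suc (toℕ i) ≡ toℕ j ⊎ suc (toℕ j) ≡ toℕ i)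
  (p-adj⇐ : ∀ i j → suc (toℕ i) ≡ toℕ j ⊎ suc (toℕ j) ≡ toℕ i → Adj G (p i) (p j))
  (connected : Connected G)
  where

  open Neighbours G
  open Walks G
  open Traces

  -- Indices beyond m are clamped to m, so that spine positions can be plain naturals.
  P : ℕ → V G
  P i = p (clamp m i)

  P-toℕ : ∀ i → P (toℕ i) ≡ p i
  P-toℕ i = cong p (toℕ-injective (toℕ-clamp (≤-pred (toℕ<n i))))

  P-injective : ∀ {i j} → i ≤ m → j ≤ m → P i ≡ P j → i ≡ j
  P-injective i≤m j≤m Pi≡Pj =
    trans (sym (toℕ-clamp i≤m)) (trans (cong toℕ (p-injective Pi≡Pj)) (toℕ-clamp j≤m))

  Adj-P⇒ : ∀ {i j} → i ≤ m → j ≤ m → Adj G (P i) (P j) → suc i ≡ j ⊎ suc j ≡ i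
  Adj-P⇒ i≤m j≤m a with p-adj⇒ _ _ a
  ... | inj₁ e = inj₁ (subst₂ (λ u w → suc u ≡ w) (toℕ-clamp i≤m) (toℕ-clamp j≤m) e)
  ... | inj₂ e = inj₂ (subst₂ (λ u w → suc w ≡ u) (toℕ-clamp i≤m) (toℕ-clamp j≤m) e)

  Adj-P-suc : ∀ {i} → i < m → Adj G (P i) (P (suc i))
  Adj-P-suc i<m = p-adj⇐ _ _ (inj₁ (trans (cong suc (toℕ-clamp (<⇒≤ i<m))) (sym (toℕ-clamp i<m))))

  Spine : V G → Set
  Spine v = ∃ λ i → p i ≡ v

  spine? : Decidable Spine
  spine? v = any? (λ i → p i ≟ᶠ v)

  Leaf : V G → Set
  Leaf v = ¬ Spine v

  P-spine : ∀ i → Spine (P i)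
  P-spine i = clamp m i , refl

  leaf-unique-neighbour : ∀ {v a b} → Leaf v → Adj G v a → Adj G v b → a ≡ b
  leaf-unique-neighbour {v} leaf = ¬InB⇒unique-neighbour (leaf ∘ InB⇒p v)

  leaf-has-spine-neighbour : ∀ {v} → Leaf v → ∃ λ u → Adj G v u × Spine u
  leaf-has-spine-neighbour {v} leaf = along (walk⇒traces (proj₂ (connected v (p zero))))
    where
    along : ∀ {W ℓ} → Traces G W v (p zero) ℓ → ∃ λ u → Adj G v u × Spine u
    along {ℓ = zero} tr = contradiction (zero , trans (sym (end tr)) (start tr)) leaf
    along {W} {suc ℓ} tr with spine? (W 1)
    ... | yes spine = W 1 , first-step tr , spine
    ... | no  leaf′ with trapped-in-edge (leaf ∘ InB⇒p v) (leaf′ ∘ InB⇒p (W 1)) (first-step tr) tr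
    ...   | inj₁ p₀≡v = contradiction (zero , p₀≡v) leaf
    ...   | inj₂ p₀≡u = contradiction (zero , p₀≡u) leaf′

  Attached : ℕ → V G → Set
  Attached i v = P i ≡ v ⊎ (Leaf v × Adj G (P i) v)

  -- Opaque, so that a later `with spine? v` cannot abstract inside π v.
  opaque
    attached : ∀ v → ∃ λ i → i ≤ m × Attached i v
    attached v with spine? v
    ... | yes (i , pi≡v) = toℕ i , ≤-pred (toℕ<n i) , inj₁ (trans (P-toℕ i) pi≡v)
    ... | no leaf with leaf-has-spine-neighbour leaf
    ...   | u , vu , (i , pi≡u) =
      toℕ i , ≤-pred (toℕ<n i) , inj₂ (leaf , Adj-sym (subst (Adj G v) (sym (trans (P-toℕ i) pi≡u)) vu))

  attached-unique : ∀ {i j v} → i ≤ m → j ≤ m → Attached i v → Attached j v → i ≡ j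
  attached-unique i≤m j≤m (inj₁ Pi≡v) (inj₁ Pj≡v) = P-injective i≤m j≤m (trans Pi≡v (sym Pj≡v))
  attached-unique _ _ (inj₁ Pi≡v) (inj₂ (leaf , _)) = contradiction (subst Spine Pi≡v (P-spine _)) leaf
  attached-unique _ _ (inj₂ (leaf , _)) (inj₁ Pj≡v) = contradiction (subst Spine Pj≡v (P-spine _)) leaf
  attached-unique i≤m j≤m (inj₂ (leaf , Piv)) (inj₂ (_ , Pjv)) =
    P-injective i≤m j≤m (leaf-unique-neighbour leaf (Adj-sym Piv) (Adj-sym Pjv))

  π : V G → ℕ
  π v = proj₁ (attached v)

  π≤m : ∀ v → π v ≤ m
  π≤m v = proj₁ (proj₂ (attached v))

  π-unique : ∀ {i v} → i ≤ m → Attached i v → π v ≡ i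
  π-unique {v = v} i≤m = attached-unique (π≤m v) i≤m (proj₂ (proj₂ (attached v)))

  π-P : ∀ {i} → i ≤ m → π (P i) ≡ i
  π-P i≤m = π-unique i≤m (inj₁ refl)

  spine-P : ∀ {v} → Spine v → v ≡ P (π v)
  spine-P {v} spine with proj₂ (proj₂ (attached v))
  ... | inj₁ Pπv≡v      = sym Pπv≡v
  ... | inj₂ (leaf , _) = contradiction spine leaf

  leaf-anchor : ∀ {v} → Leaf v → Adj G (P (π v)) v
  leaf-anchor {v} leaf with proj₂ (proj₂ (attached v))
  ... | inj₁ Pπv≡v        = contradiction (subst Spine Pπv≡v (P-spine _)) leaf
  ... | inj₂ (_ , anchor) = anchor

  leaf-neighbour : ∀ {v u} → Leaf v → Adj G v u → u ≡ P (π v)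
  leaf-neighbour leaf vu = leaf-unique-neighbour leaf vu (Adj-sym (leaf-anchor leaf))

  opaque
    depth : V G → ℕ
    depth v = if does (spine? v) then 0 else 1

    depth-spine : ∀ {v} → Spine v → depth v ≡ 0
    depth-spine {v} spine rewrite dec-true (spine? v) spine = refl

    depth-leaf : ∀ {v} → Leaf v → depth v ≡ 1
    depth-leaf {v} leaf rewrite dec-false (spine? v) leaf = refl

    depth≤1 : ∀ v → depth v ≤ 1
    depth≤1 v with does (spine? v)
    ... | true  = z≤n
    ... | false = ≤-refl

  π-step : ∀ {u v} → Adj G u v → π v ≤ suc (π u)
  π-step {u} {v} uv with spine? u | spine? v
  ... | no leaf | _ =
    ≤-trans (≤-reflexive (trans (cong π (leaf-neighbour leaf uv)) (π-P (π≤m u)))) (n≤1+n _)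
  ... | yes _ | no leaf =
    ≤-trans (≤-reflexive (sym (trans (cong π (leaf-neighbour leaf (Adj-sym uv))) (π-P (π≤m v))))) (n≤1+n _)
  ... | yes su | yes sv with Adj-P⇒ (π≤m u) (π≤m v) (subst₂ (Adj G) (spine-P su) (spine-P sv) uv)
  ...   | inj₁ 1+πu≡πv = ≤-reflexive (sym 1+πu≡πv)
  ...   | inj₂ 1+πv≡πu = ≤-trans (n≤1+n _) (≤-trans (≤-reflexive 1+πv≡πu) (n≤1+n _))

  π-risesSlowly : ∀ {W x y ℓ} → Traces G W x y ℓ → RisesSlowly (π ∘ W) ℓ
  π-risesSlowly tr t t<ℓ = π-step (step tr t t<ℓ)

  π-walk-bound : ∀ {W x y ℓ} → Traces G W x y ℓ → π y ≤ π x + ℓ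
  π-walk-bound {ℓ = ℓ} tr =
    subst₂ (λ a b → π a ≤ π b + ℓ) (end tr) (start tr) (risesSlowly-bound (π-risesSlowly tr))

  leaf-first-step : ∀ {W x y ℓ} → Leaf x → Traces G W x y (suc ℓ) → W 1 ≡ P (π x)
  leaf-first-step leaf tr = leaf-neighbour leaf (first-step tr)

  leaf-last-step : ∀ {W x y ℓ} → Leaf y → Traces G W x y (suc ℓ) → W ℓ ≡ P (π y)
  leaf-last-step leaf tr = leaf-neighbour leaf (Adj-sym (last-step tr))

  restart-at-anchor : ∀ {W x y ℓ} → x ≢ y → Traces G W x y ℓ →
    ∃₂ λ ℓ′ W′ → ℓ ≡ depth x + ℓ′ × Traces G W′ (P (π x)) y ℓ′
  restart-at-anchor {ℓ = zero} x≢y tr = contradiction (trans (sym (start tr)) (end tr)) x≢y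
  restart-at-anchor {W} {x} {y} {suc ℓ} x≢y tr with spine? x
  ... | yes spine = suc ℓ , W , cong (_+ suc ℓ) (sym (depth-spine spine)) ,
                    subst (λ z → Traces G W z y (suc ℓ)) (spine-P spine) tr
  ... | no leaf   = ℓ , W ∘ suc , cong (_+ ℓ) (sym (depth-leaf leaf)) ,
                    subst (λ z → Traces G (W ∘ suc) z y ℓ) (leaf-first-step leaf tr) (traces-tail tr)

  stop-at-anchor : ∀ {W x y ℓ} → Spine x → Traces G W x y ℓ →
    ∃ λ ℓ′ → ℓ ≡ ℓ′ + depth y × Traces G W x (P (π y)) ℓ′
  stop-at-anchor {W} {x} {y} {ℓ} sx tr with spine? y
  ... | yes sy =
    ℓ , sym (trans (cong (ℓ +_) (depth-spine sy)) (+-identityʳ ℓ)) ,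
    subst (λ z → Traces G W x z ℓ) (spine-P sy) tr
  stop-at-anchor {ℓ = zero} sx tr | no leaf =
    contradiction (subst Spine (trans (sym (start tr)) (end tr)) sx) leaf
  stop-at-anchor {W} {x} {y} {suc ℓ} sx tr | no leaf =
    ℓ , trans (+-comm 1 ℓ) (cong (ℓ +_) (sym (depth-leaf leaf))) ,
    subst (λ z → Traces G W x z ℓ) (leaf-last-step leaf tr) (traces-init tr)

  distance-lower-bound : ∀ {W x y ℓ} → x ≢ y → Traces G W x y ℓ →
    depth x + (π y + depth y) ≤ π x + ℓ
  distance-lower-bound {x = x} {y} {ℓ} x≢y tr with restart-at-anchor x≢y tr
  ... | ℓ₁ , W₁ , ℓ≡ , tr₁ with stop-at-anchor (P-spine (π x)) tr₁
  ...   | ℓ₂ , ℓ₁≡ , tr₂ = begin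
    depth x + (π y + depth y)         ≤⟨ +-monoʳ-≤ (depth x) (+-monoˡ-≤ (depth y) πy≤πx+ℓ₂) ⟩
    depth x + ((π x + ℓ₂) + depth y)  ≡⟨ shuffle (depth x) (π x) ℓ₂ (depth y) ⟩
    π x + (depth x + (ℓ₂ + depth y))  ≡⟨ cong (λ l → π x + (depth x + l)) ℓ₁≡ ⟨
    π x + (depth x + ℓ₁)              ≡⟨ cong (π x +_) ℓ≡ ⟨
    π x + ℓ                           ∎
    where
    open ≤-Reasoning
    πy≤πx+ℓ₂ : π y ≤ π x + ℓ₂
    πy≤πx+ℓ₂ = subst₂ (λ a b → a ≤ b + ℓ₂) (π-P (π≤m y)) (π-P (π≤m x)) (π-walk-bound tr₂)
    shuffle : ∀ a b c d → a + ((b + c) + d) ≡ b + (a + (c + d))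
    shuffle = solve-∀

  spine-crossing : ∀ {W x y ℓ j} → Traces G W x y ℓ → π x < j → j < π y →
    ∃ λ t → 0 < t × t < ℓ × W t ≡ P j
  spine-crossing {W} {x} {y} {ℓ} {j} tr πx<j j<πy =
    inner-hit (risesSlowly-hits (π-risesSlowly tr) (subst (_≤ j) πx≡πW₀ (<⇒≤ πx<j))
                                                   (subst (j ≤_) πy≡πWℓ (<⇒≤ j<πy)))
    where
    πx≡πW₀ : π x ≡ π (W 0)
    πx≡πW₀ = cong π (sym (start tr))
    πy≡πWℓ : π y ≡ π (W ℓ)
    πy≡πWℓ = cong π (sym (end tr))
    crossing : ∀ s → 0 < s → s < ℓ → π (W s) ≡ j → ∃ λ t → 0 < t × t < ℓ × W t ≡ P j
    crossing s 0<s s<ℓ πWs≡j with spine? (W s)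
    ... | yes spine = s , 0<s , s<ℓ , trans (spine-P spine) (cong P πWs≡j)
    ... | no leaf   = suc s , z<s , ≤∧≢⇒< s<ℓ 1+s≢ℓ , W[1+s]≡Pj
      where
      W[1+s]≡Pj : W (suc s) ≡ P j
      W[1+s]≡Pj = trans (leaf-neighbour leaf (step tr s s<ℓ)) (cong P πWs≡j)
      1+s≢ℓ : suc s ≢ ℓ
      1+s≢ℓ refl = <-irrefl (sym (trans (cong π (trans (sym (end tr)) W[1+s]≡Pj))
                                         (π-P (≤-trans (<⇒≤ j<πy) (π≤m y)))))
                            j<πy
    inner-hit : (∃ λ s → s ≤ ℓ × π (W s) ≡ j) → ∃ λ t → 0 < t × t < ℓ × W t ≡ P j
    inner-hit (s , s≤ℓ , πWs≡j) =
      crossing s (n≢0⇒n>0 λ { refl → <-irrefl (trans πx≡πW₀ πWs≡j) πx<j })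
                 (≤∧≢⇒< s≤ℓ λ { refl → <-irrefl (sym (trans πy≡πWℓ πWs≡j)) j<πy }) πWs≡j

  SpineBelow : ℕ → V G → Set
  SpineBelow b v = ∃ λ j → j < b × v ≡ P j

  walk-from-spine : ∀ {y} d i → d + i ≡ π y →
    ∃₂ λ ℓ W → i + ℓ ≡ π y + depth y × Traces G W (P i) y ℓ ×
               Interior (SpineBelow (π y + depth y)) W ℓ
  walk-from-spine {y} zero i i≡πy with spine? y
  ... | yes spine =
    0 , (λ _ → y) , trans (cong (_+ 0) i≡πy) (cong (π y +_) (sym (depth-spine spine))) ,
    subst (λ z → Traces G (λ _ → y) z y 0) (trans (spine-P spine) (cong P (sym i≡πy))) (traces-const y) ,
    λ _ _ ()
  ... | no leaf =
    1 , P i ◂ (λ _ → y) , trans (cong (_+ 1) i≡πy) (cong (π y +_) (sym (depth-leaf leaf))) ,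
    traces-◂ (subst (λ k → Adj G (P k) y) (sym i≡πy) (leaf-anchor leaf)) (traces-const y) ,
    interior-◂ {Q = SpineBelow (π y + depth y)} (λ _ _ ()) (λ ())
  walk-from-spine {y} (suc d) i 1+d+i≡πy with walk-from-spine d (suc i) (trans (+-suc d i) 1+d+i≡πy)
  ... | ℓ , W , len , tr , inner =
    suc ℓ , P i ◂ W , trans (+-suc i ℓ) len ,
    traces-◂ (Adj-P-suc (≤-trans (≤-trans (s≤s (m≤n+m i d)) (≤-reflexive 1+d+i≡πy)) (π≤m y))) tr ,
    interior-◂ {Q = SpineBelow (π y + depth y)} inner
               (λ 0<ℓ → suc i , subst (suc i <_) len (m<m+n (suc i) 0<ℓ) , start tr)

  walk-between : ∀ {x y} → π x ≤ π y →
    ∃₂ λ ℓ W → π x + ℓ ≡ depth x + (π y + depth y) × Traces G W x y ℓ ×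
               Interior (SpineBelow (π y + depth y)) W ℓ
  walk-between {x} {y} πx≤πy with walk-from-spine (π y ∸ π x) (π x) (m∸n+n≡m πx≤πy) | spine? x
  ... | ℓ , W , len , tr , inner | yes spine =
    ℓ , W , trans len (cong (_+ (π y + depth y)) (sym (depth-spine spine))) ,
    subst (λ z → Traces G W z y ℓ) (sym (spine-P spine)) tr , inner
  ... | ℓ , W , len , tr , inner | no leaf =
    suc ℓ , x ◂ W ,
    trans (+-suc (π x) ℓ) (trans (cong suc len) (cong (_+ (π y + depth y)) (sym (depth-leaf leaf)))) ,
    traces-◂ (Adj-sym (leaf-anchor leaf)) tr ,
    interior-◂ {Q = SpineBelow (π y + depth y)} inner
               (λ 0<ℓ → π x , subst (π x <_) len (m<m+n (π x) 0<ℓ) , start tr)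

  walk-between-length≤ : ∀ {x y ℓ} → π x + ℓ ≡ depth x + (π y + depth y) → ℓ ≤ suc (suc m)
  walk-between-length≤ {x} {y} {ℓ} len = begin
    ℓ                          ≤⟨ m≤n+m ℓ (π x) ⟩
    π x + ℓ                    ≡⟨ len ⟩
    depth x + (π y + depth y)  ≤⟨ +-mono-≤ (depth≤1 x) (+-mono-≤ (π≤m y) (depth≤1 y)) ⟩
    1 + (m + 1)                ≡⟨ cong suc (+-comm m 1) ⟩
    suc (suc m)                ∎
    where open ≤-Reasoning

  diameter≤ : ∀ {D} → IsDiam G D → D ≤ suc (suc m)
  diameter≤ (_ , x , y , _ , shortest) with ≤-total (π x) (π y)
  ... | inj₁ πx≤πy =
    let ℓ , W , len , tr , _ = walk-between πx≤πy
    in ≤-trans (≮⇒≥ λ ℓ<D → shortest ℓ ℓ<D (traces⇒walk tr)) (walk-between-length≤ len)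
  ... | inj₂ πy≤πx =
    let ℓ , W , len , tr , _ = walk-between πy≤πx
    in ≤-trans (≮⇒≥ λ ℓ<D → shortest ℓ ℓ<D (walk-reverse (traces⇒walk tr)))
               (walk-between-length≤ len)

  visible-both-ways : ∀ {S k x y} → x ≢ y → π x ≤ π y → depth x + (π y + depth y) ≤ π x + k →
    (∀ {v} → SpineBelow (π y + depth y) v → v ∉ S) → Visible G S k x y × Visible G S k y x
  visible-both-ways {S} {k} {x} {y} x≢y πx≤πy span≤k hidden =
    let ℓ , W , len , tr , inner = walk-between πx≤πy
        ℓ≤k = +-cancelˡ-≤ (π x) ℓ k (subst (_≤ π x + k) (sym len) span≤k)
        shortest : ∀ m → m < ℓ → ¬ Walk G x y m
        shortest m m<ℓ wk = <⇒≱ m<ℓ (+-cancelˡ-≤ (π x) ℓ m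
          (subst (_≤ π x + m) (sym len) (distance-lower-bound x≢y (walk⇒traces wk))))
        unseen : Interior (_∉ S) W ℓ
        unseen t 0<t t<ℓ = hidden (inner t 0<t t<ℓ)
    in traces⇒visible tr ℓ≤k shortest unseen ,
       traces⇒visible (traces-reverse tr) ℓ≤k (λ m m<ℓ → shortest m m<ℓ ∘ walk-reverse)
                      (interior-reverse {Q = _∉ S} unseen)

  module Regular (q′ : ℕ) (degree-spine : ∀ v → InB G v → degree G v ≡ suc (suc q′)) where

    LeafIn : ℕ → ℕ → V G → Set
    LeafIn a b v = Leaf v × a ≤ π v × π v < b

    leafIn? : ∀ a b → Decidable (LeafIn a b)
    leafIn? a b v = ¬? (spine? v) ×-dec (a ≤? π v ×-dec π v <? b)

    leavesIn : ℕ → ℕ → ℕ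
    leavesIn a b = count (leafIn? a b)

    leavesIn-empty : ∀ a → leavesIn a a ≡ 0
    leavesIn-empty a = count≡0 (leafIn? a a) λ _ (_ , a≤πv , πv<a) → <⇒≱ πv<a a≤πv

    leavesIn-additive : ∀ {a b c} → a ≤ b → b ≤ c → leavesIn a c ≡ leavesIn a b + leavesIn b c
    leavesIn-additive {a} {b} {c} a≤b b≤c =
      trans (count-cong (leafIn? a c) (leafIn? a b ∪? leafIn? b c) split merge)
            (count-∪-disjoint (leafIn? a b) (leafIn? b c)
                              λ (_ , _ , πv<b) (_ , b≤πv , _) → <⇒≱ πv<b b≤πv)
      where
      split : LeafIn a c ⊆ LeafIn a b ∪ LeafIn b c
      split {v} (leaf , a≤πv , πv<c) with π v <? b
      ... | yes πv<b = inj₁ (leaf , a≤πv , πv<b)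
      ... | no  πv≮b = inj₂ (leaf , ≮⇒≥ πv≮b , πv<c)
      merge : LeafIn a b ∪ LeafIn b c ⊆ LeafIn a c
      merge (inj₁ (leaf , a≤πv , πv<b)) = leaf , a≤πv , <-≤-trans πv<b b≤c
      merge (inj₂ (leaf , b≤πv , πv<c)) = leaf , ≤-trans a≤b b≤πv , πv<c

    SpineNeighbour LeafNeighbour : ℕ → V G → Set
    SpineNeighbour i v = Adj G (P i) v × Spine v
    LeafNeighbour  i v = Adj G (P i) v × Leaf v

    spineNeighbour? : ∀ i → Decidable (SpineNeighbour i)
    spineNeighbour? i v = adj? G (P i) v ×-dec spine? v

    spineNeighbours : ℕ → ℕ
    spineNeighbours i = count (spineNeighbour? i)

    degree-split : ∀ {i} → i ≤ m → spineNeighbours i + leavesIn i (suc i) ≡ suc (suc q′)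
    degree-split {i} i≤m = begin
      spineNeighbours i + leavesIn i (suc i)     ≡⟨ cong (spineNeighbours i +_) hanging ⟩
      spineNeighbours i + count leafNeighbour?   ≡⟨ count-∪-disjoint (spineNeighbour? i) leafNeighbour?
                                                                     (λ (_ , spine) (_ , leaf) → leaf spine) ⟨
      count (spineNeighbour? i ∪? leafNeighbour?) ≡⟨ count-cong _ (adj? G (P i)) adjacent by-kind ⟩
      count (adj? G (P i))                       ≡⟨ degree≡count (P i) ⟨
      degree G (P i)                             ≡⟨ degree-spine (P i) (p-InB (clamp m i)) ⟩
      suc (suc q′)                               ∎
      where
      open ≡-Reasoning
      leafNeighbour? : Decidable (LeafNeighbour i)
      leafNeighbour? v = adj? G (P i) v ×-dec ¬? (spine? v)
      hangs : LeafIn i (suc i) ⊆ LeafNeighbour i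
      hangs {v} (leaf , i≤πv , πv<1+i) =
        subst (λ k → Adj G (P k) v) (≤-antisym (≤-pred πv<1+i) i≤πv) (leaf-anchor leaf) , leaf
      unhangs : LeafNeighbour i ⊆ LeafIn i (suc i)
      unhangs (Piv , leaf) =
        let πv≡i = π-unique i≤m (inj₂ (leaf , Piv))
        in leaf , ≤-reflexive (sym πv≡i) , s≤s (≤-reflexive πv≡i)
      hanging : leavesIn i (suc i) ≡ count leafNeighbour?
      hanging = count-cong _ leafNeighbour? hangs unhangs
      adjacent : SpineNeighbour i ∪ LeafNeighbour i ⊆ Adj G (P i)
      adjacent (inj₁ (Piv , _)) = Piv
      adjacent (inj₂ (Piv , _)) = Piv
      by-kind : Adj G (P i) ⊆ SpineNeighbour i ∪ LeafNeighbour i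
      by-kind {v} Piv with spine? v
      ... | yes spine = inj₁ (Piv , spine)
      ... | no  leaf  = inj₂ (Piv , leaf)

    spine-neighbour-index : ∀ {i v} → i ≤ m → SpineNeighbour i v → suc i ≡ π v ⊎ suc (π v) ≡ i
    spine-neighbour-index {i} {v} i≤m (Piv , spine) =
      Adj-P⇒ i≤m (π≤m v) (subst (Adj G (P i)) (spine-P spine) Piv)

    spine-neighbour-below : ∀ {i} → 0 < i → i ≤ m → SpineNeighbour i (P (pred i))
    spine-neighbour-below {i} 0<i i≤m =
      Adj-sym (subst (λ k → Adj G (P (pred i)) (P k)) (suc-pred i {{>-nonZero 0<i}})
                     (Adj-P-suc (<-≤-trans (pred[n]<n 0<i) i≤m))) ,
      P-spine (pred i)

    spine-neighbour-above : ∀ {i} → i < m → SpineNeighbour i (P (suc i))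
    spine-neighbour-above i<m = Adj-P-suc i<m , P-spine _

    spineNeighbours-first : 0 < m → spineNeighbours 0 ≡ 1
    spineNeighbours-first 0<m = count≡1 (spineNeighbour? 0) (spine-neighbour-above 0<m) only
      where
      only : ∀ {v} → SpineNeighbour 0 v → v ≡ P 1
      only nb with spine-neighbour-index z≤n nb
      ... | inj₁ 1≡πv = trans (spine-P (proj₂ nb)) (cong P (sym 1≡πv))

    spineNeighbours-last : 0 < m → spineNeighbours m ≡ 1
    spineNeighbours-last 0<m = count≡1 (spineNeighbour? m) (spine-neighbour-below 0<m ≤-refl) only
      where
      only : ∀ {v} → SpineNeighbour m v → v ≡ P (pred m)
      only {v} nb with spine-neighbour-index ≤-refl nb
      ... | inj₁ 1+m≡πv = contradiction (subst (_≤ m) (sym 1+m≡πv) (π≤m v)) (<-irrefl refl)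
      ... | inj₂ 1+πv≡m = trans (spine-P (proj₂ nb)) (cong P (cong pred 1+πv≡m))

    spineNeighbours-inner : ∀ {i} → 0 < i → i < m → spineNeighbours i ≡ 2
    spineNeighbours-inner {i} 0<i i<m =
      count≡2 (spineNeighbour? i) distinct
              (spine-neighbour-below 0<i (<⇒≤ i<m)) (spine-neighbour-above i<m) only
      where
      distinct : P (pred i) ≢ P (suc i)
      distinct e = <-irrefl (P-injective (≤-trans pred[n]≤n (<⇒≤ i<m)) i<m e) (s≤s pred[n]≤n)
      only : ∀ {v} → SpineNeighbour i v → v ≡ P (pred i) ⊎ v ≡ P (suc i)
      only nb with spine-neighbour-index (<⇒≤ i<m) nb
      ... | inj₁ 1+i≡πv = inj₂ (trans (spine-P (proj₂ nb)) (cong P (sym 1+i≡πv)))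
      ... | inj₂ 1+πv≡i = inj₁ (trans (spine-P (proj₂ nb)) (cong P (cong pred 1+πv≡i)))

    leavesAt-first : 0 < m → leavesIn 0 1 ≡ suc q′
    leavesAt-first 0<m =
      suc-injective (trans (cong (_+ leavesIn 0 1) (sym (spineNeighbours-first 0<m))) (degree-split z≤n))

    leavesAt-last : 0 < m → leavesIn m (suc m) ≡ suc q′
    leavesAt-last 0<m =
      suc-injective (trans (cong (_+ leavesIn m (suc m)) (sym (spineNeighbours-last 0<m))) (degree-split ≤-refl))

    leavesAt-inner : ∀ {i} → 0 < i → i < m → leavesIn i (suc i) ≡ q′
    leavesAt-inner {i} 0<i i<m = suc-injective (suc-injective
      (trans (cong (_+ leavesIn i (suc i)) (sym (spineNeighbours-inner 0<i i<m))) (degree-split (<⇒≤ i<m))))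

    leavesAt≤ : ∀ {i} → 0 < m → i ≤ m → leavesIn i (suc i) ≤ suc q′
    leavesAt≤ {zero}  0<m _ = ≤-reflexive (leavesAt-first 0<m)
    leavesAt≤ {suc i} 0<m 1+i≤m with m≤n⇒m<n∨m≡n 1+i≤m
    ... | inj₁ 1+i<m = ≤-trans (≤-reflexive (leavesAt-inner z<s 1+i<m)) (n≤1+n q′)
    ... | inj₂ 1+i≡m =
      subst (λ k → leavesIn k (suc k) ≤ suc q′) (sym 1+i≡m) (≤-reflexive (leavesAt-last 0<m))

    leavesIn-inner : ∀ {a} d → 0 < a → a + d ≤ m → leavesIn a (a + d) ≡ d * q′
    leavesIn-inner {a} zero    0<a _       = trans (cong (leavesIn a) (+-identityʳ a)) (leavesIn-empty a)
    leavesIn-inner {a} (suc d) 0<a a+1+d≤m = begin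
      leavesIn a (a + suc d)                              ≡⟨ cong (leavesIn a) (+-suc a d) ⟩
      leavesIn a (suc (a + d))                            ≡⟨ leavesIn-additive (m≤m+n a d) (n≤1+n _) ⟩
      leavesIn a (a + d) + leavesIn (a + d) (suc (a + d)) ≡⟨ cong₂ _+_ (leavesIn-inner d 0<a (<⇒≤ a+d<m))
                                                                      (leavesAt-inner 0<a+d a+d<m) ⟩
      d * q′ + q′                                         ≡⟨ +-comm (d * q′) q′ ⟩
      suc d * q′                                          ∎
      where
      open ≡-Reasoning
      a+d<m : a + d < m
      a+d<m = subst (_≤ m) (+-suc a d) a+1+d≤m
      0<a+d : 0 < a + d
      0<a+d = <-≤-trans 0<a (m≤m+n a d)

    leavesIn-prefix : ∀ {K} → K < m → leavesIn 0 (suc K) ≡ suc q′ + K * q′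
    leavesIn-prefix {K} K<m =
      trans (leavesIn-additive z≤n (s≤s z≤n))
            (cong₂ _+_ (leavesAt-first (≤-<-trans z≤n K<m)) (leavesIn-inner K z<s K<m))

    leavesIn-all : 0 < m → leavesIn 0 (suc m) ≡ suc (suc q′ + m * q′)
    leavesIn-all 0<m = begin
      leavesIn 0 (suc m)
        ≡⟨ leavesIn-additive z≤n (n≤1+n m) ⟩
      leavesIn 0 m + leavesIn m (suc m)
        ≡⟨ cong (λ k → leavesIn 0 k + leavesIn m (suc m)) m≡1+pm ⟩
      leavesIn 0 (suc pm) + leavesIn m (suc m)
        ≡⟨ cong₂ _+_ (leavesIn-prefix (pred[n]<n 0<m)) (leavesAt-last 0<m) ⟩
      suc q′ + pm * q′ + suc q′
        ≡⟨ regroup (suc q′) (pm * q′) q′ ⟩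
      suc (suc q′ + suc pm * q′)
        ≡⟨ cong (λ k → suc (suc q′ + k * q′)) m≡1+pm ⟨
      suc (suc q′ + m * q′)
        ∎
      where
      open ≡-Reasoning
      pm : ℕ
      pm = pred m
      m≡1+pm : m ≡ suc pm
      m≡1+pm = sym (suc-pred m {{>-nonZero 0<m}})
      regroup : ∀ a b c → a + b + suc c ≡ suc (a + (c + b))
      regroup = solve-∀

    module LowerBound (K : ℕ) (K≤m : K ≤ m) (0<m : 0 < m) where

      SpineAt1+K : V G → Set
      SpineAt1+K v = Spine v × π v ≡ suc K

      spineAt1+K? : Decidable SpineAt1+K
      spineAt1+K? v = spine? v ×-dec (π v ≟ suc K)

      Chosen : V G → Set
      Chosen v = LeafIn 0 (suc K) v ⊎ SpineAt1+K v

      chosen? : Decidable Chosen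
      chosen? v = leafIn? 0 (suc K) v ⊎-dec spineAt1+K? v

      chosen : Subset (order G)
      chosen = toSubset chosen?

      chosen-reach : ∀ {v} → Chosen v → π v + depth v ≤ suc K
      chosen-reach {v} (inj₁ (leaf , _ , πv<1+K)) =
        subst (_≤ suc K) (sym (trans (cong (π v +_) (depth-leaf leaf)) (+-comm (π v) 1))) πv<1+K
      chosen-reach {v} (inj₂ (spine , πv≡1+K)) =
        ≤-reflexive (trans (cong (π v +_) (depth-spine spine)) (trans (+-identityʳ (π v)) πv≡1+K))

      spineBelow∉chosen : ∀ {v} → SpineBelow (suc K) v → v ∉ chosen
      spineBelow∉chosen {v} (j , j<1+K , v≡Pj) v∈ with ∈-toSubset⁻ chosen? v∈
      ... | inj₁ (leaf , _)   = leaf (subst Spine (sym v≡Pj) (P-spine j))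
      ... | inj₂ (_ , πv≡1+K) =
        <-irrefl (trans (sym (π-P (≤-trans (≤-pred j<1+K) K≤m))) (trans (cong π (sym v≡Pj)) πv≡1+K))
                 j<1+K

      span-chosen : ∀ {x y} → Chosen x → Chosen y → x ≢ y → π x ≤ π y →
        depth x + (π y + depth y) ≤ π x + (2 + K)
      span-chosen (inj₂ (sx , πx≡1+K)) (inj₂ (sy , πy≡1+K)) x≢y _ =
        contradiction (trans (spine-P sx) (trans (cong P (trans πx≡1+K (sym πy≡1+K))) (sym (spine-P sy)))) x≢y
      span-chosen (inj₂ (_ , πx≡1+K)) (inj₁ (_ , _ , πy<1+K)) _ πx≤πy =
        contradiction (subst (_< suc K) πx≡1+K (≤-<-trans πx≤πy πy<1+K)) (<-irrefl refl)
      span-chosen {x} {y} (inj₁ (leaf , _)) y∈ _ _ = begin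
        depth x + (π y + depth y)  ≡⟨ cong (_+ (π y + depth y)) (depth-leaf leaf) ⟩
        suc (π y + depth y)        ≤⟨ s≤s (chosen-reach y∈) ⟩
        2 + K                      ≤⟨ m≤n+m (2 + K) (π x) ⟩
        π x + (2 + K)              ∎
        where open ≤-Reasoning

      chosen-visible : IsKDMV G (2 + K) chosen
      chosen-visible x y x∈ y∈ = visible (∈-toSubset⁻ chosen? x∈) (∈-toSubset⁻ chosen? y∈)
        where
        hidden : ∀ {z v} → Chosen z → SpineBelow (π z + depth z) v → v ∉ chosen
        hidden z∈ (j , j<reach , v≡Pj) =
          spineBelow∉chosen (j , <-≤-trans j<reach (chosen-reach z∈) , v≡Pj)
        visible : Chosen x → Chosen y → Visible G chosen (2 + K) x y
        visible x∈ y∈ with x ≟ᶠ y | ≤-total (π x) (π y)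
        ... | yes refl | _ = traces⇒visible (traces-const x) z≤n (λ _ ()) (λ _ _ ())
        ... | no x≢y | inj₁ πx≤πy =
          proj₁ (visible-both-ways x≢y πx≤πy (span-chosen x∈ y∈ x≢y πx≤πy) (hidden y∈))
        ... | no x≢y | inj₂ πy≤πx =
          let y≢x = x≢y ∘ sym
          in proj₂ (visible-both-ways y≢x πy≤πx (span-chosen y∈ x∈ y≢x πy≤πx) (hidden x∈))

      ∣chosen∣ : ∣ chosen ∣ ≡ 2 + suc K * q′
      ∣chosen∣ = begin
        ∣ chosen ∣                               ≡⟨ ∣toSubset∣≡count chosen? ⟩
        count chosen?                            ≡⟨ count-∪-disjoint (leafIn? 0 (suc K)) spineAt1+K?
                                                                     (λ (leaf , _) (spine , _) → leaf spine) ⟩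
        leavesIn 0 (suc K) + count spineAt1+K?   ≡⟨ by-cases (m≤n⇒m<n∨m≡n K≤m) ⟩
        2 + suc K * q′                           ∎
        where
        open ≡-Reasoning
        by-cases : K < m ⊎ K ≡ m → leavesIn 0 (suc K) + count spineAt1+K? ≡ 2 + suc K * q′
        by-cases (inj₁ K<m) = begin
          leavesIn 0 (suc K) + count spineAt1+K?
            ≡⟨ cong₂ _+_ (leavesIn-prefix K<m) (count≡1 spineAt1+K? here only) ⟩
          suc q′ + K * q′ + 1
            ≡⟨ +-comm _ 1 ⟩
          2 + suc K * q′
            ∎
          where
          here : SpineAt1+K (P (suc K))
          here = P-spine (suc K) , π-P K<m
          only : ∀ {v} → SpineAt1+K v → v ≡ P (suc K)
          only (spine , πv≡1+K) = trans (spine-P spine) (cong P πv≡1+K)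
        by-cases (inj₂ K≡m) = begin
          leavesIn 0 (suc K) + count spineAt1+K?
            ≡⟨ cong₂ _+_ (cong (λ k → leavesIn 0 (suc k)) K≡m) none ⟩
          leavesIn 0 (suc m) + 0
            ≡⟨ +-identityʳ _ ⟩
          leavesIn 0 (suc m)
            ≡⟨ leavesIn-all 0<m ⟩
          suc (suc q′ + m * q′)
            ≡⟨ cong (λ k → suc (suc q′ + k * q′)) K≡m ⟨
          2 + suc K * q′
            ∎
          where
          none : count spineAt1+K? ≡ 0
          none = count≡0 spineAt1+K? λ v (_ , πv≡1+K) →
            <-irrefl πv≡1+K (s≤s (subst (π v ≤_) (sym K≡m) (π≤m v)))

    module UpperBound (K : ℕ) (S : Subset (order G)) (S-visible : IsKDMV G (2 + K) S) (0<m : 0 < m) where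

      short-walk : ∀ {x y} → x ∈ S → y ∈ S →
        ∃₂ λ ℓ W → ℓ ≤ 2 + K × Traces G W x y ℓ × Interior (_∉ S) W ℓ
      short-walk x∈ y∈ = visible⇒traces (S-visible _ _ x∈ y∈)

      anchor-hidden : ∀ {x y} → Leaf x → x ∈ S → y ∈ S → y ≢ x → y ≢ P (π x) → P (π x) ∉ S
      anchor-hidden leaf x∈ y∈ y≢x y≢anchor with short-walk x∈ y∈
      ... | zero        , _ , _ , tr , _     = contradiction (trans (sym (end tr)) (start tr)) y≢x
      ... | suc zero    , _ , _ , tr , _     =
        contradiction (trans (sym (end tr)) (leaf-first-step leaf tr)) y≢anchor
      ... | suc (suc ℓ) , _ , _ , tr , inner =
        subst (_∉ S) (leaf-first-step leaf tr) (inner 1 z<s (s<s z<s))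

      spine-hidden : ∀ {x y j} → x ∈ S → y ∈ S → π x < j → j < π y → P j ∉ S
      spine-hidden x∈ y∈ πx<j j<πy =
        let ℓ , W , _ , tr , inner = short-walk x∈ y∈
            t , 0<t , t<ℓ , Wt≡Pj = spine-crossing tr πx<j j<πy
        in subst (_∉ S) Wt≡Pj (inner t 0<t t<ℓ)

      span≤ : ∀ {x y} → x ∈ S → y ∈ S → x ≢ y → depth x + (π y + depth y) ≤ π x + (2 + K)
      span≤ {x} x∈ y∈ x≢y =
        let ℓ , W , ℓ≤ , tr , _ = short-walk x∈ y∈
        in ≤-trans (distance-lower-bound x≢y tr) (+-monoʳ-≤ (π x) ℓ≤)

      MemberAt : ℕ → V G → Set
      MemberAt a v = v ∈ S × π v ≡ a

      memberAt? : ∀ a → Decidable (MemberAt a)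
      memberAt? a v = (v ∈? S) ×-dec (π v ≟ a)

      members-at-end : ∀ {x y} → x ∈ S → y ∈ S → π y ≢ π x →
        count (memberAt? (π x)) ≤ 1 + depth x * q′
      members-at-end {x} {y} x∈ y∈ πy≢πx with spine? x
      ... | yes spine = subst (λ d → count (memberAt? (π x)) ≤ 1 + d * q′) (sym (depth-spine spine))
                              (count≤1 (memberAt? (π x)) λ u v → trans (only u) (sym (only v)))
        where
        only : ∀ {v} → MemberAt (π x) v → v ≡ x
        only {v} (v∈ , πv≡πx) with spine? v
        ... | yes spine-v = trans (spine-P spine-v) (trans (cong P πv≡πx) (sym (spine-P spine)))
        ... | no  leaf-v  =
          contradiction x∈ (subst (_∉ S) (trans (cong P πv≡πx) (sym (spine-P spine)))
            (anchor-hidden leaf-v v∈ y∈ (λ { refl → πy≢πx πv≡πx })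
                           (λ y≡Pπv → πy≢πx (trans (cong π y≡Pπv) (trans (π-P (π≤m v)) πv≡πx)))))
      ... | no leaf = subst (λ d → count (memberAt? (π x)) ≤ 1 + d * q′) (sym (depth-leaf leaf)) (begin
          count (memberAt? (π x))
            ≤⟨ count-mono (memberAt? (π x)) (leafIn? (π x) (suc (π x))) leaf-member ⟩
          leavesIn (π x) (suc (π x))
            ≤⟨ leavesAt≤ 0<m (π≤m x) ⟩
          suc q′
            ≡⟨ cong suc (+-identityʳ q′) ⟨
          1 + 1 * q′
            ∎)
        where
        open ≤-Reasoning
        anchor∉S : P (π x) ∉ S
        anchor∉S = anchor-hidden leaf x∈ y∈ (λ { refl → πy≢πx refl })
                                 (λ y≡Pπx → πy≢πx (trans (cong π y≡Pπx) (π-P (π≤m x))))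
        leaf-member : MemberAt (π x) ⊆ LeafIn (π x) (suc (π x))
        leaf-member {v} (v∈ , πv≡πx) =
          (λ spine-v → anchor∉S (subst (_∈ S) (trans (spine-P spine-v) (cong P πv≡πx)) v∈)) ,
          ≤-reflexive (sym πv≡πx) , s≤s (≤-reflexive πv≡πx)

      single-position-bound : ∀ {a} → a ≤ m → (∀ {v} → v ∈ S → π v ≡ a) →
        count (_∈? S) ≤ 2 + suc K * q′
      single-position-bound {a} a≤m at-a with P a ∈? S
      ... | yes Pa∈S = begin
          count (_∈? S)
            ≤⟨ count-mono (_∈? S) ((_≟ᶠ P a) ∪? memberLeaf?) anchor-or-leaf ⟩
          count ((_≟ᶠ P a) ∪? memberLeaf?)
            ≤⟨ count-∪≤ (_≟ᶠ P a) memberLeaf? ⟩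
          count (_≟ᶠ P a) + count memberLeaf?
            ≤⟨ +-mono-≤ (≤-reflexive (count-singleton (P a))) (count≤1 memberLeaf? one-leaf) ⟩
          2
            ≤⟨ m≤m+n 2 _ ⟩
          2 + suc K * q′
            ∎
        where
        open ≤-Reasoning
        MemberLeaf : V G → Set
        MemberLeaf v = v ∈ S × Leaf v
        memberLeaf? : Decidable MemberLeaf
        memberLeaf? v = (v ∈? S) ×-dec ¬? (spine? v)
        anchor-or-leaf : (_∈ S) ⊆ (_≡ P a) ∪ MemberLeaf
        anchor-or-leaf {v} v∈ with spine? v
        ... | yes spine = inj₁ (trans (spine-P spine) (cong P (at-a v∈)))
        ... | no  leaf  = inj₂ (v∈ , leaf)
        one-leaf : ∀ {u v} → MemberLeaf u → MemberLeaf v → u ≡ v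
        one-leaf {u} {v} (u∈ , leaf-u) (v∈ , leaf-v) with u ≟ᶠ v
        ... | yes u≡v = u≡v
        ... | no  u≢v = contradiction (subst (_∈ S) (cong P (sym (at-a u∈))) Pa∈S)
          (anchor-hidden leaf-u u∈ v∈ (u≢v ∘ sym)
                         λ v≡Pπu → leaf-v (subst Spine (sym v≡Pπu) (P-spine _)))
      ... | no Pa∉S = begin
          count (_∈? S)       ≤⟨ count-mono (_∈? S) (leafIn? a (suc a)) leaf-at-a ⟩
          leavesIn a (suc a)  ≤⟨ leavesAt≤ 0<m a≤m ⟩
          suc q′              ≤⟨ s≤s (≤-trans (m≤m+n q′ _) (n≤1+n _)) ⟩
          2 + suc K * q′      ∎
        where
        open ≤-Reasoning
        leaf-at-a : (_∈ S) ⊆ LeafIn a (suc a)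
        leaf-at-a {v} v∈ =
          (λ spine → Pa∉S (subst (_∈ S) (trans (spine-P spine) (cong P (at-a v∈))) v∈)) ,
          ≤-reflexive (sym (at-a v∈)) , s≤s (≤-reflexive (at-a v∈))

      two-positions-bound : ∀ {xa xb} → xa ∈ S → xb ∈ S →
        (∀ {v} → v ∈ S → π xa ≤ π v) → (∀ {v} → v ∈ S → π v ≤ π xb) → π xa < π xb →
        count (_∈? S) ≤ 2 + suc K * q′
      two-positions-bound {xa} {xb} xa∈ xb∈ least greatest a<b = begin
        count (_∈? S)
          ≤⟨ by-parts ⟩
        count (memberAt? a) + (leavesIn (suc a) b + count (memberAt? b))
          ≤⟨ +-mono-≤ first (+-mono-≤ (≤-reflexive inner) last) ⟩
        (1 + depth xa * q′) + (d * q′ + (1 + depth xb * q′))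
          ≤⟨ sum-of-parts≤ a d (depth xa) (depth xb) K q′ span ⟩
        2 + suc K * q′
          ∎
        where
        open ≤-Reasoning
        a b d : ℕ
        a = π xa
        b = π xb
        d = b ∸ suc a
        1+a+d≡b : suc a + d ≡ b
        1+a+d≡b = m+[n∸m]≡n a<b
        inner-or-last? : Decidable (LeafIn (suc a) b ∪ MemberAt b)
        inner-or-last? = leafIn? (suc a) b ∪? memberAt? b
        parts? : Decidable (MemberAt a ∪ (LeafIn (suc a) b ∪ MemberAt b))
        parts? = memberAt? a ∪? inner-or-last?
        by-position : (_∈ S) ⊆ MemberAt a ∪ (LeafIn (suc a) b ∪ MemberAt b)
        by-position {v} v∈ with π v ≟ a | π v ≟ b
        ... | yes πv≡a | _        = inj₁ (v∈ , πv≡a)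
        ... | no _     | yes πv≡b = inj₂ (inj₂ (v∈ , πv≡b))
        ... | no πv≢a  | no πv≢b  = inj₂ (inj₁ (leaf , a<πv , πv<b))
          where
          a<πv : a < π v
          a<πv = ≤∧≢⇒< (least v∈) (πv≢a ∘ sym)
          πv<b : π v < b
          πv<b = ≤∧≢⇒< (greatest v∈) πv≢b
          leaf : Leaf v
          leaf spine = spine-hidden xa∈ xb∈ a<πv πv<b (subst (_∈ S) (spine-P spine) v∈)
        first : count (memberAt? a) ≤ 1 + depth xa * q′
        first = members-at-end xa∈ xb∈ λ b≡a → <-irrefl (sym b≡a) a<b
        last : count (memberAt? b) ≤ 1 + depth xb * q′
        last = members-at-end xb∈ xa∈ λ a≡b → <-irrefl a≡b a<b
        inner : leavesIn (suc a) b ≡ d * q′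
        inner = trans (cong (leavesIn (suc a)) (sym 1+a+d≡b))
                      (leavesIn-inner d z<s (subst (_≤ m) (sym 1+a+d≡b) (π≤m xb)))
        span : depth xa + ((suc a + d) + depth xb) ≤ a + (2 + K)
        span = subst (λ k → depth xa + (k + depth xb) ≤ a + (2 + K)) (sym 1+a+d≡b)
                     (span≤ xa∈ xb∈ λ xa≡xb → <-irrefl (cong π xa≡xb) a<b)
        by-parts : count (_∈? S) ≤ count (memberAt? a) + (leavesIn (suc a) b + count (memberAt? b))
        by-parts = begin
          count (_∈? S)
            ≤⟨ count-mono (_∈? S) parts? by-position ⟩
          count parts?
            ≤⟨ count-∪≤ (memberAt? a) inner-or-last? ⟩
          count (memberAt? a) + count inner-or-last?
            ≤⟨ +-monoʳ-≤ _ (count-∪≤ (leafIn? (suc a) b) (memberAt? b)) ⟩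
          count (memberAt? a) + (leavesIn (suc a) b + count (memberAt? b))
            ∎

      ∣S∣≤ : ∣ S ∣ ≤ 2 + suc K * q′
      ∣S∣≤ rewrite ∣p∣≡count S with extremum ≤-refl ≤-trans ≤-total (_∈? S) π
      ... | inj₁ empty = ≤-trans (≤-reflexive (count≡0 (_∈? S) empty)) z≤n
      ... | inj₂ (xa , xa∈ , least)
        with extremum {_≼_ = _≥_} ≤-refl (λ a≥b b≥c → ≤-trans b≥c a≥b) (λ a b → ≤-total b a)
                      (_∈? S) π
      ...   | inj₁ empty = contradiction xa∈ (empty xa)
      ...   | inj₂ (xb , xb∈ , greatest) with m≤n⇒m<n∨m≡n (least xb∈)
      ...     | inj₁ a<b = two-positions-bound xa∈ xb∈ least greatest a<b
      ...     | inj₂ a≡b = single-position-bound (π≤m xa) λ v∈ →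
                             ≤-antisym (≤-trans (greatest v∈) (≤-reflexive (sym a≡b))) (least v∈)

corollary4p4 : (T : Graph) (r q k : ℕ) →
    IsCaterpillar T → IsDiam T (suc r) → 3 ≤ r →
    2 ≤ q → (∀ v → InB T v → degree T v ≡ q) →
    2 ≤ k → k ≤ suc r →
    IsMuK T k (k * (q ∸ 2) + 4 ∸ q)
corollary4p4 T (suc r) q k (_ , zero , _ , _ , _ , InB⇒p , _) diam (s≤s _) _ _ _ _ =
  ⊥-elim (¬Fin0 (proj₁ (InB⇒p _ (proj₂ (Walks.InB-nonempty T diam)))))
corollary4p4 T r (suc (suc q′)) (suc (suc K))
             ((connected , _) , suc m , p , p-injective , p-InB , InB⇒p , p-adj⇒ , p-adj⇐)
             diam 3≤r (s≤s (s≤s z≤n)) degree≡q (s≤s (s≤s z≤n)) k≤1+r =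
  subst (IsMuK T (2 + K)) (sym (μ-formula K q′))
        ((chosen , chosen-visible , ∣chosen∣) , λ S S-visible → UpperBound.∣S∣≤ K S S-visible 0<m)
  where
  open Caterpillar T m p p-injective p-InB InB⇒p p-adj⇒ p-adj⇐ connected
  open Regular q′ degree≡q
  K≤m : K ≤ m
  K≤m = ≤-pred (≤-pred (≤-trans k≤1+r (diameter≤ diam)))
  0<m : 0 < m
  0<m = ≤-trans (s≤s z≤n) (≤-pred (≤-pred (≤-trans (s≤s 3≤r) (diameter≤ diam))))
  open LowerBound K K≤m 0<m
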